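{- Each of the normal modal logics $\mathsf{K}$, $\mathsf{D}$, $\mathsf{KT}$, $\mathsf{K4}$, $\mathsf{KD4}$, $\mathsf{S4}$, $\mathsf{GL}$ has both the modal disjunctive interpolation property $\mathrm{MDIP}$ and its monotone version $\mathrm{mMDIP}$.
   Context: Modal formulas are over $\{\top,\bot,\wedge,\vee,\to,\Box\}$; $V(\phi)$ is the set of atoms of $\phi$; a formula is monotone if it contains no implication (so no negation, as $\neg\phi:=\phi\to\bot$). For a modal logic $L$, an $L$-modal disjunctive interpolant ($L$-MDI) for $(\phi\to\Box\psi\vee\Box\theta)\in L$ is a pair $(I,J)$ with $V(I),V(J)\subseteq V(\phi)$ such that $\phi\to(I\vee J)$, $I\to\Box\psi$ and $J\to\Box\theta$ are in $L$; an $L$-mMDI additionally requires $\phi$, $I$, $J$ monotone. $L$ has MDIP if every such formula in $L$ has an $L$-MDI, and mMDIP if every such formula in $L$ with $\phi$ monotone has an $L$-mMDI. -}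

module Defs where

open import Data.Nat using (ℕ)
open import Data.Bool using (Bool; true; false; _∧_; _∨_; not)
open import Data.Product using (Σ; _×_; _,_)
open import Data.Empty using (⊥)
open import Data.Unit using (⊤)
open import Data.Sum using (_⊎_)
open import Relation.Binary.PropositionalEquality using (_≡_)

infixr 6 _∧ᶠ_
infixr 5 _∨ᶠ_
infixr 4 _⇒_
data Fm : Set where
  var  : ℕ → Fm
  ⊤ᶠ   : Fm
  ⊥ᶠ   : Fm
  _∧ᶠ_ : Fm → Fm → Fm
  _∨ᶠ_ : Fm → Fm → Fm
  _⇒_  : Fm → Fm → Fm
  □_   : Fm → Fm

¬ᶠ_ : Fm → Fm
¬ᶠ φ = φ ⇒ ⊥ᶠ

◇_ : Fm → Fm
◇ φ = ¬ᶠ (□ (¬ᶠ φ))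

Occ : ℕ → Fm → Set
Occ p (var q)   = p ≡ q
Occ p ⊤ᶠ        = ⊥
Occ p ⊥ᶠ        = ⊥
Occ p (φ ∧ᶠ ψ)  = Occ p φ ⊎ Occ p ψ
Occ p (φ ∨ᶠ ψ)  = Occ p φ ⊎ Occ p ψ
Occ p (φ ⇒ ψ)   = Occ p φ ⊎ Occ p ψ
Occ p (□ φ)     = Occ p φ

_⊆V_ : Fm → Fm → Set
ψ ⊆V φ = ∀ p → Occ p ψ → Occ p φ

data Monotone : Fm → Set where
  mvar : ∀ n → Monotone (var n)
  m⊤   : Monotone ⊤ᶠ
  m⊥   : Monotone ⊥ᶠ
  m∧   : ∀ {φ ψ} → Monotone φ → Monotone ψ → Monotone (φ ∧ᶠ ψ)
  m∨   : ∀ {φ ψ} → Monotone φ → Monotone ψ → Monotone (φ ∨ᶠ ψ)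
  m□   : ∀ {φ} → Monotone φ → Monotone (□ φ)

evalB : (ℕ → Bool) → (Fm → Bool) → Fm → Bool
evalB f g (var n)  = f n
evalB f g ⊤ᶠ       = true
evalB f g ⊥ᶠ       = false
evalB f g (φ ∧ᶠ ψ) = evalB f g φ ∧ evalB f g ψ
evalB f g (φ ∨ᶠ ψ) = evalB f g φ ∨ evalB f g ψ
evalB f g (φ ⇒ ψ)  = not (evalB f g φ) ∨ evalB f g ψ
evalB f g (□ φ)    = g φ

-- substitution instances of classical propositional tautologies
Taut : Fm → Set
Taut φ = ∀ f g → evalB f g φ ≡ true

data Logic : Set where
  K D KT K4 KD4 S4 GL : Logic

data Ax : Logic → Fm → Set where
  axD-D    : ∀ φ → Ax D   (□ φ ⇒ ◇ φ)
  axD-KD4  : ∀ φ → Ax KD4 (□ φ ⇒ ◇ φ)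
  ax4-KD4  : ∀ φ → Ax KD4 (□ φ ⇒ □ □ φ)
  axT-KT   : ∀ φ → Ax KT  (□ φ ⇒ φ)
  ax4-K4   : ∀ φ → Ax K4  (□ φ ⇒ □ □ φ)
  axT-S4   : ∀ φ → Ax S4  (□ φ ⇒ φ)
  ax4-S4   : ∀ φ → Ax S4  (□ φ ⇒ □ □ φ)
  axL-GL   : ∀ φ → Ax GL  (□ (□ φ ⇒ φ) ⇒ □ φ)

-- Theoremhood in the normal modal logic L: smallest set containing all
-- tautologies, the K axiom and the extra axioms (as schemas, hence closed
-- under substitution), closed under modus ponens and necessitation.
infix 2 _⊢_
data _⊢_ (L : Logic) : Fm → Set where
  taut : ∀ {φ} → Taut φ → L ⊢ φ
  axK  : ∀ φ ψ → L ⊢ □ (φ ⇒ ψ) ⇒ (□ φ ⇒ □ ψ)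
  ax   : ∀ {φ} → Ax L φ → L ⊢ φ
  mp   : ∀ {φ ψ} → L ⊢ φ ⇒ ψ → L ⊢ φ → L ⊢ ψ
  nec  : ∀ {φ} → L ⊢ φ → L ⊢ □ φ

MDI : Logic → Fm → Fm → Fm → Set
MDI L φ ψ θ = Σ Fm λ I → Σ Fm λ J →
  (I ⊆V φ) × (J ⊆V φ) ×
  (L ⊢ φ ⇒ (I ∨ᶠ J)) × (L ⊢ I ⇒ □ ψ) × (L ⊢ J ⇒ □ θ)

MDIP : Logic → Set
MDIP L = ∀ φ ψ θ → L ⊢ φ ⇒ (□ ψ ∨ᶠ □ θ) → MDI L φ ψ θ

mMDIP : Logic → Set
mMDIP L = ∀ φ ψ θ → Monotone φ → L ⊢ φ ⇒ (□ ψ ∨ᶠ □ θ) →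
  Σ Fm λ I → Σ Fm λ J →
  Monotone I × Monotone J ×
  (I ⊆V φ) × (J ⊆V φ) ×
  (L ⊢ φ ⇒ (I ∨ᶠ J)) × (L ⊢ I ⇒ □ ψ) × (L ⊢ J ⇒ □ θ)

-- Each of the seven logics is decidable, with finite countermodels. Start from all Hintikka types
-- over the primes (atoms and boxed subformulas) of χ and repeatedly discard the types that lack a
-- required successor or violate reflexivity; the characteristic formula of a discarded type is
-- refutable in L, so L still proves the disjunction of the remaining ones. The survivors form a
-- finite L-model: either all of them satisfy χ, and then L ⊢ χ, or one of them refutes χ.
--
-- Given L ⊢ φ → □ψ ∨ □θ, let I (resp. J) be the disjunction of the characteristic formulas of the
-- types t over the primes of φ with L ⊢ t → □ψ (resp. t → □θ). If a world of an L-model satisfied φ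
-- but neither I nor J, its type t would have countermodels to both t → □ψ and t → □θ; placing them
-- below a new root of type t (reflexive if L is) gives an L-model whose root satisfies φ but neither
-- □ψ nor □θ. For monotone φ, the positive part of each type suffices: the new root satisfies every
-- monotone formula that t makes true.

module Submission where

open import Defs
open import Data.Bool using (Bool; true; false; T; not; _∧_; _∨_; if_then_else_)
open import Data.Bool.ListAction using (all; any; and)
open import Data.Bool.Properties using (T?; T-≡)
open import Data.Empty using (⊥; ⊥-elim)
open import Data.Fin using (Fin)
open import Data.List using (List; []; _∷_; _++_; map; foldr; concatMap; filter; filterᵇ; length; lookup; allFin)
open import Data.List.Membership.Propositional using (_∈_; find; lose)
open import Data.List.Membership.Propositional.Properties
  using (∈-++⁻; ∈-++⁺ˡ; ∈-++⁺ʳ; ∈-map⁺; ∈-map⁻; ∈-concat⁺′; ∈-concat⁻′; ∈-filter⁺; ∈-filter⁻;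
         ∈-lookup; ∈-allFin)
open import Data.List.Properties using (length-filter; filter-notAll; map-∘; map-cong)
open import Data.List.Relation.Binary.Subset.Propositional using (_⊆_)
open import Data.List.Relation.Unary.All as All using (All; []; _∷_; all?)
open import Data.List.Relation.Unary.All.Properties as Allₚ using (all⁺; all⁻; all-anti-mono; ¬All⇒Any¬)
open import Data.List.Relation.Unary.Any using (Any; here; there; index)
open import Data.List.Relation.Unary.Any.Properties as Anyₚ using (any⁺; any⁻; lookup-index)
open import Data.Maybe using (Maybe; just; nothing; maybe)
open import Data.Nat using (ℕ; _<_; _≤_; _∸_; z≤n; s≤s; _≡ᵇ_)
open import Data.Nat.Induction using (<-wellFounded)
open import Data.Nat.Properties using (≡ᵇ⇒≡; ≡⇒≡ᵇ; ∸-monoʳ-<; m≤n⇒m≤1+n)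
open import Data.Product using (Σ; ∃-syntax; _×_; _,_; proj₁; proj₂)
open import Data.Sum using (_⊎_; inj₁; inj₂; [_,_]; [_,_]′)
open import Data.Unit using (⊤; tt)
open import Function using (_∘_; Equivalence)
open import Induction.WellFounded using (WellFounded; Acc; acc; module Subrelation)
import Relation.Binary.Construct.On as On
open import Relation.Binary.PropositionalEquality using (_≡_; refl; sym; trans; cong; cong₂; subst; module ≡-Reasoning)
open import Relation.Nullary using (¬_; Dec; yes; no)

private variable
  L : Logic
  A B C X : Fm
  Γ As P Q : List Fm
  a b : Bool
  f : ℕ → Bool
  g : Fm → Bool

_⇒ᵇ_ : Bool → Bool → Bool
a ⇒ᵇ b = not a ∨ b

⇒ᵇ-intro : ∀ a → (T a → T b) → T (a ⇒ᵇ b)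
⇒ᵇ-intro false _ = tt
⇒ᵇ-intro true  h = h tt

⇒ᵇ-elim : ∀ a → T (a ⇒ᵇ b) → T a → T b
⇒ᵇ-elim true h _ = h

⇒ᵇ-counter : ∀ a → ¬ T (a ⇒ᵇ b) → T a × ¬ T b
⇒ᵇ-counter false h = ⊥-elim (h tt)
⇒ᵇ-counter true  h = tt , h

∧ᵇ-intro : T a → T b → T (a ∧ b)
∧ᵇ-intro {true} _ h = h

∧ᵇ-elim : T (a ∧ b) → T a × T b
∧ᵇ-elim {true} h = tt , h

∨ᵇ-introˡ : ∀ b → T a → T (a ∨ b)
∨ᵇ-introˡ {true} _ _ = tt

∨ᵇ-introʳ : ∀ a → T b → T (a ∨ b)
∨ᵇ-introʳ true  _ = tt
∨ᵇ-introʳ false h = h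

∨ᵇ-elim : T (a ∨ b) → T a ⊎ T b
∨ᵇ-elim {true}  h = inj₁ h
∨ᵇ-elim {false} h = inj₂ h

¬ᵇ-intro : ∀ a → ¬ T a → T (a ⇒ᵇ false)
¬ᵇ-intro false _ = tt
¬ᵇ-intro true  h = h tt

T-injective : (T a → T b) → (T b → T a) → a ≡ b
T-injective {false} {false} _ _ = refl
T-injective {false} {true}  _ h = ⊥-elim (h tt)
T-injective {true}  {false} h _ = ⊥-elim (h tt)
T-injective {true}  {true}  _ _ = refl

T-not : ¬ T a → T (not a)
T-not {false} _ = tt
T-not {true}  h = h tt

¬T-not : T (not a) → ¬ T a
¬T-not {true} () _

∧-not : T a → ¬ T (a ∧ not b) → T b
∧-not {true} {false} _ h = ⊥-elim (h tt)
∧-not {true} {true}  _ _ = tt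

∨ᵇ-counter : ∀ a → ¬ T (a ∨ b) → ¬ T a × ¬ T b
∨ᵇ-counter a h = h ∘ ∨ᵇ-introˡ _ , h ∘ ∨ᵇ-introʳ a

¬all⇒any¬ : ∀ {I : Set} (p : I → Bool) xs → ¬ T (all p xs) → ∃[ x ] x ∈ xs × ¬ T (p x)
¬all⇒any¬ p xs h = find (¬All⇒Any¬ (T? ∘ p) xs (h ∘ all⁻ p))

length-filterᵇ-mono : ∀ {I : Set} {p q : I → Bool} xs → (∀ {x} → x ∈ xs → T (p x) → T (q x)) →
                      length (filterᵇ p xs) ≤ length (filterᵇ q xs)
length-filterᵇ-mono [] _ = z≤n
length-filterᵇ-mono {p = p} {q} (y ∷ ys) p⇒q with p y in ep | q y in eq
... | true  | true  = s≤s (length-filterᵇ-mono ys (p⇒q ∘ there))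
... | true  | false = ⊥-elim (subst T eq (p⇒q (here refl) (subst T (sym ep) tt)))
... | false | true  = m≤n⇒m≤1+n (length-filterᵇ-mono ys (p⇒q ∘ there))
... | false | false = length-filterᵇ-mono ys (p⇒q ∘ there)

length-filterᵇ-< : ∀ {I : Set} {p q : I → Bool} xs → (∀ {x} → x ∈ xs → T (p x) → T (q x)) →
                   ∀ {x} → x ∈ xs → T (q x) → ¬ T (p x) → length (filterᵇ p xs) < length (filterᵇ q xs)
length-filterᵇ-< {p = p} {q} (y ∷ ys) p⇒q m qx ¬px with p y in ep | q y in eq | m
... | true  | false | _ = ⊥-elim (subst T eq (p⇒q (here refl) (subst T (sym ep) tt)))
... | true  | true  | here refl = ⊥-elim (¬px (subst T (sym ep) tt))
... | true  | true  | there m′ = s≤s (length-filterᵇ-< ys (p⇒q ∘ there) m′ qx ¬px)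
... | false | true  | _ = s≤s (length-filterᵇ-mono ys (p⇒q ∘ there))
... | false | false | here refl = ⊥-elim (subst T eq qx)
... | false | false | there m′ = length-filterᵇ-< ys (p⇒q ∘ there) m′ qx ¬px

⋀ ⋁ : List Fm → Fm
⋀ = foldr _∧ᶠ_ ⊤ᶠ
⋁ = foldr _∨ᶠ_ ⊥ᶠ

Holds : (ℕ → Bool) → (Fm → Bool) → Fm → Set
Holds f g A = T (evalB f g A)

module _ {f : ℕ → Bool} {g : Fm → Bool} where

  ⋀-holds⁺ : All (Holds f g) As → Holds f g (⋀ As)
  ⋀-holds⁺ []       = tt
  ⋀-holds⁺ (h ∷ hs) = ∧ᵇ-intro h (⋀-holds⁺ hs)

  ⋀-holds⁻ : ∀ As → Holds f g (⋀ As) → All (Holds f g) As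
  ⋀-holds⁻ []       _ = []
  ⋀-holds⁻ (A ∷ As) h = proj₁ (∧ᵇ-elim h) ∷ ⋀-holds⁻ As (proj₂ (∧ᵇ-elim {evalB f g A} h))

  ⋁-holds⁺ : Any (Holds f g) As → Holds f g (⋁ As)
  ⋁-holds⁺ {A ∷ As} (here h)  = ∨ᵇ-introˡ (evalB f g (⋁ As)) h
  ⋁-holds⁺ {A ∷ As} (there h) = ∨ᵇ-introʳ (evalB f g A) (⋁-holds⁺ h)

  ⋁-holds⁻ : ∀ As → Holds f g (⋁ As) → Any (Holds f g) As
  ⋁-holds⁻ (A ∷ As) h with ∨ᵇ-elim {evalB f g A} h
  ... | inj₁ h′ = here h′
  ... | inj₂ h′ = there (⋁-holds⁻ As h′)

infixr 4 _⇛_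
_⇛_ : List Fm → Fm → Fm
[]      ⇛ B = B
(A ∷ Γ) ⇛ B = A ⇒ Γ ⇛ B

-- A right-nested product rather than All, so that premises can be taken apart by a plain λ.
Holds⋆ : (ℕ → Bool) → (Fm → Bool) → List Fm → Set
Holds⋆ f g = foldr (λ A R → Holds f g A × R) ⊤

infix 3 _⊨ᵖ_
_⊨ᵖ_ : List Fm → Fm → Set
Γ ⊨ᵖ A = ∀ f g → Holds⋆ f g Γ → Holds f g A

⇛-holds : ∀ {f g} Γ → (Holds⋆ f g Γ → Holds f g B) → Holds f g (Γ ⇛ B)
⇛-holds []               h = h tt
⇛-holds {f = f} {g} (A ∷ Γ) h = ⇒ᵇ-intro (evalB f g A) λ a → ⇛-holds Γ (h ∘ (a ,_))

mp⋆ : L ⊢ Γ ⇛ B → All (L ⊢_) Γ → L ⊢ B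
mp⋆ d []       = d
mp⋆ d (e ∷ es) = mp⋆ (mp d e) es

⊢-consequence : All (L ⊢_) Γ → Γ ⊨ᵖ A → L ⊢ A
⊢-consequence {Γ = Γ} ds h =
  mp⋆ (taut λ f g → Equivalence.to T-≡ (⇛-holds Γ (h f g))) ds

⇒-trans : L ⊢ A ⇒ B → L ⊢ B ⇒ C → L ⊢ A ⇒ C
⇒-trans {A = A} {B} d e = ⊢-consequence (d ∷ e ∷ []) λ f g (ab , bc , _) →
  ⇒ᵇ-intro (evalB f g A) λ a → ⇒ᵇ-elim (evalB f g B) bc (⇒ᵇ-elim (evalB f g A) ab a)

⇒-contradiction : L ⊢ X ⇒ A → L ⊢ X ⇒ ¬ᶠ A → L ⊢ X ⇒ ⊥ᶠ
⇒-contradiction {X = X} {A} d e = ⊢-consequence (d ∷ e ∷ []) λ f g (xa , x¬a , _) →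
  ⇒ᵇ-intro (evalB f g X) λ x → ⇒ᵇ-elim (evalB f g A) (⇒ᵇ-elim (evalB f g X) x¬a x) (⇒ᵇ-elim (evalB f g X) xa x)

⇒-⊥-elim : L ⊢ X ⇒ ⊥ᶠ → L ⊢ X ⇒ A
⇒-⊥-elim {X = X} d = ⊢-consequence (d ∷ []) λ f g (x⊥ , _) →
  ⇒ᵇ-intro (evalB f g X) λ x → ⊥-elim (⇒ᵇ-elim (evalB f g X) x⊥ x)

□-mono : L ⊢ A ⇒ B → L ⊢ □ A ⇒ □ B
□-mono {A = A} {B} d = mp (axK A B) (nec d)

□-∧ : L ⊢ □ A ⇒ □ B ⇒ □ (A ∧ᶠ B)
□-∧ {A = A} {B} = ⇒-trans (□-mono pair) (axK B (A ∧ᶠ B))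
  where
  pair : _ ⊢ A ⇒ B ⇒ A ∧ᶠ B
  pair = ⊢-consequence [] λ f g _ →
    ⇒ᵇ-intro (evalB f g A) λ a → ⇒ᵇ-intro (evalB f g B) λ b → ∧ᵇ-intro a b

□-⋀-intro : ∀ Bs → (∀ {B} → B ∈ Bs → L ⊢ X ⇒ □ B) → L ⊢ X ⇒ □ ⋀ Bs
□-⋀-intro {X = X} [] _ = ⊢-consequence (nec (⊢-consequence [] λ _ _ _ → tt) ∷ []) λ f g (□⊤ , _) →
  ⇒ᵇ-intro (evalB f g X) λ _ → □⊤
□-⋀-intro {X = X} (B ∷ Bs) d =
  ⊢-consequence (d (here refl) ∷ □-⋀-intro Bs (d ∘ there) ∷ □-∧ ∷ []) λ f g (x□b , x□c , □∧ , _) →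
    ⇒ᵇ-intro (evalB f g X) λ x →
      ⇒ᵇ-elim (g (⋀ Bs)) (⇒ᵇ-elim (g B) □∧ (⇒ᵇ-elim (evalB f g X) x□b x)) (⇒ᵇ-elim (evalB f g X) x□c x)

⋁-intro : ∀ {I : Set} (F : I → Fm) {i is} → i ∈ is → L ⊢ F i ⇒ ⋁ (map F is)
⋁-intro F {i} {is} m = ⊢-consequence [] λ f g _ →
  ⇒ᵇ-intro (evalB f g (F i)) λ h → ⋁-holds⁺ (Anyₚ.map⁺ (lose m h))

⋁-elim : ∀ {I : Set} (F : I → Fm) is → (∀ {i} → i ∈ is → L ⊢ F i ⇒ B) → L ⊢ ⋁ (map F is) ⇒ B
⋁-elim F [] _ = ⊢-consequence [] λ _ _ _ → tt
⋁-elim {B = B} F (i ∷ is) d = ⊢-consequence (d (here refl) ∷ ⋁-elim F is (d ∘ there) ∷ []) λ f g (h₁ , h₂ , _) →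
  ⇒ᵇ-intro (evalB f g (F i ∨ᶠ ⋁ (map F is))) λ h → either h₁ h₂ (∨ᵇ-elim {evalB f g (F i)} h)
  where
  either : ∀ {x y z} → T (x ⇒ᵇ z) → T (y ⇒ᵇ z) → T x ⊎ T y → T z
  either {x} h₁ _ (inj₁ hx)     = ⇒ᵇ-elim x h₁ hx
  either {y = y} _ h₂ (inj₂ hy) = ⇒ᵇ-elim y h₂ hy

isSerial isReflexive isTransitive hasLöb : Logic → Bool
isSerial D   = true
isSerial KD4 = true
isSerial _   = false
isReflexive KT = true
isReflexive S4 = true
isReflexive _  = false
isTransitive K4  = true
isTransitive KD4 = true
isTransitive S4  = true
isTransitive GL  = true
isTransitive _   = false
hasLöb GL = true
hasLöb _  = false

Löb⇒transitive : T (hasLöb L) → T (isTransitive L)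
Löb⇒transitive {GL} _ = tt

serial⇒¬Löb : T (isSerial L) → ¬ T (hasLöb L)
serial⇒¬Löb {D}   _ ()
serial⇒¬Löb {KD4} _ ()

reflexive⇒¬Löb : T (isReflexive L) → ¬ T (hasLöb L)
reflexive⇒¬Löb {KT} _ ()
reflexive⇒¬Löb {S4} _ ()

⊢-T : T (isReflexive L) → L ⊢ □ A ⇒ A
⊢-T {KT} _ = ax (axT-KT _)
⊢-T {S4} _ = ax (axT-S4 _)

D⇒¬□⊥ : L ⊢ □ ⊥ᶠ ⇒ ◇ ⊥ᶠ → L ⊢ □ ⊥ᶠ ⇒ ⊥ᶠ
D⇒¬□⊥ d = ⊢-consequence (d ∷ nec (⊢-consequence [] λ _ _ _ → tt) ∷ []) λ f g (h , □¬⊥ , _) →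
  ⇒ᵇ-intro (g ⊥ᶠ) λ □⊥ → ⇒ᵇ-elim (g (¬ᶠ ⊥ᶠ)) (⇒ᵇ-elim (g ⊥ᶠ) h □⊥) □¬⊥

⊢-D : T (isSerial L) → L ⊢ □ ⊥ᶠ ⇒ ⊥ᶠ
⊢-D {D}   _ = D⇒¬□⊥ (ax (axD-D ⊥ᶠ))
⊢-D {KD4} _ = D⇒¬□⊥ (ax (axD-KD4 ⊥ᶠ))

⊢-Löb : T (hasLöb L) → L ⊢ □ (□ A ⇒ A) ⇒ □ A
⊢-Löb {GL} _ = ax (axL-GL _)

-- In GL, axiom 4 follows from Löb's axiom instantiated at A ∧ □A.
⊢-4 : T (isTransitive L) → L ⊢ □ A ⇒ □ □ A
⊢-4 {K4}  _ = ax (ax4-K4 _)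
⊢-4 {KD4} _ = ax (ax4-KD4 _)
⊢-4 {S4}  _ = ax (ax4-S4 _)
⊢-4 {GL} {A} _ = ⇒-trans (□-mono A⇒Löb-premise) (⇒-trans (ax (axL-GL (A ∧ᶠ □ A))) (□-mono ∧-elimʳ))
  where
  ∧-elimˡ : GL ⊢ A ∧ᶠ □ A ⇒ A
  ∧-elimˡ = ⊢-consequence [] λ f g _ → ⇒ᵇ-intro (evalB f g A ∧ g A) (proj₁ ∘ ∧ᵇ-elim)
  ∧-elimʳ : GL ⊢ A ∧ᶠ □ A ⇒ □ A
  ∧-elimʳ = ⊢-consequence [] λ f g _ → ⇒ᵇ-intro (evalB f g A ∧ g A) (proj₂ ∘ ∧ᵇ-elim {evalB f g A})
  A⇒Löb-premise : GL ⊢ A ⇒ □ (A ∧ᶠ □ A) ⇒ A ∧ᶠ □ A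
  A⇒Löb-premise = ⊢-consequence (□-mono ∧-elimˡ ∷ []) λ f g (h , _) →
    ⇒ᵇ-intro (evalB f g A) λ a → ⇒ᵇ-intro (g (A ∧ᶠ □ A)) λ b →
      ∧ᵇ-intro a (⇒ᵇ-elim (g (A ∧ᶠ □ A)) h b)

-- Kripke semantics

-- Successors come as a list, so that truth of □A is computed; all models here are image-finite.
record Model : Set₁ where
  field
    W          : Set
    successors : W → List W
    val        : W → ℕ → Bool
open Model

sat : (M : Model) → W M → Fm → Bool
sat M w (var n)  = val M w n
sat M w ⊤ᶠ       = true
sat M w ⊥ᶠ       = false
sat M w (A ∧ᶠ B) = sat M w A ∧ sat M w B
sat M w (A ∨ᶠ B) = sat M w A ∨ sat M w B
sat M w (A ⇒ B)  = sat M w A ⇒ᵇ sat M w B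
sat M w (□ A)    = all (λ v → sat M v A) (successors M w)

sat-evalB : ∀ M w A → sat M w A ≡ evalB (val M w) (λ B → sat M w (□ B)) A
sat-evalB M w (var n)  = refl
sat-evalB M w ⊤ᶠ       = refl
sat-evalB M w ⊥ᶠ       = refl
sat-evalB M w (A ∧ᶠ B) = cong₂ _∧_ (sat-evalB M w A) (sat-evalB M w B)
sat-evalB M w (A ∨ᶠ B) = cong₂ _∨_ (sat-evalB M w A) (sat-evalB M w B)
sat-evalB M w (A ⇒ B)  = cong₂ _⇒ᵇ_ (sat-evalB M w A) (sat-evalB M w B)
sat-evalB M w (□ A)    = refl

module Box (M : Model) {w : W M} where

  □-sat⁻ : ∀ A → T (sat M w (□ A)) → ∀ {v} → v ∈ successors M w → T (sat M v A)
  □-sat⁻ A h = All.lookup (all⁺ _ _ h)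

  □-sat⁺ : ∀ A → (∀ {v} → v ∈ successors M w → T (sat M v A)) → T (sat M w (□ A))
  □-sat⁺ A h = all⁻ _ (All.tabulate h)

module _ {M : Model} {w : W M} where

  sat-⋁⁺ : ∀ {I : Set} (F : I → Fm) {xs x} → x ∈ xs → T (sat M w (F x)) → T (sat M w (⋁ (map F xs)))
  sat-⋁⁺ F {y ∷ ys} (here refl) h = ∨ᵇ-introˡ (sat M w (⋁ (map F ys))) h
  sat-⋁⁺ F {y ∷ ys} (there m)   h = ∨ᵇ-introʳ (sat M w (F y)) (sat-⋁⁺ F m h)

  sat-⋀⁺ : ∀ {As} → All (T ∘ sat M w) As → T (sat M w (⋀ As))
  sat-⋀⁺ []       = _
  sat-⋀⁺ (h ∷ hs) = ∧ᵇ-intro h (sat-⋀⁺ hs)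

  sat-⋀⁻ : ∀ As → T (sat M w (⋀ As)) → All (T ∘ sat M w) As
  sat-⋀⁻ []       _ = []
  sat-⋀⁻ (A ∷ As) h = proj₁ (∧ᵇ-elim h) ∷ sat-⋀⁻ As (proj₂ (∧ᵇ-elim {sat M w A} h))

Serial Reflexive Transitive ConverseWellFounded : Model → Set
Serial M     = ∀ w → ∃[ v ] v ∈ successors M w
Reflexive M  = ∀ w → w ∈ successors M w
Transitive M = ∀ {u v w} → v ∈ successors M u → w ∈ successors M v → w ∈ successors M u
ConverseWellFounded M = WellFounded (λ v w → v ∈ successors M w)

record IsModelOf (L : Logic) (M : Model) : Set where
  field
    serial     : T (isSerial L)     → Serial M
    reflexive  : T (isReflexive L)  → Reflexive M
    transitive : T (isTransitive L) → Transitive M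
    converseWF : T (hasLöb L)       → ConverseWellFounded M

module _ (M : Model) where
  open Box M

  sat-D : ∀ A → Serial M → ∀ w → T (sat M w (□ A ⇒ ◇ A))
  sat-D A ser w = ⇒ᵇ-intro (sat M w (□ A)) λ □a → ¬ᵇ-intro (sat M w (□ (¬ᶠ A))) λ □¬a →
    let v , m = ser w in ⇒ᵇ-elim (sat M v A) (□-sat⁻ (¬ᶠ A) □¬a m) (□-sat⁻ A □a m)

  sat-T : ∀ A → Reflexive M → ∀ w → T (sat M w (□ A ⇒ A))
  sat-T A refl′ w = ⇒ᵇ-intro (sat M w (□ A)) λ □a → □-sat⁻ A □a (refl′ w)

  sat-4 : ∀ A → Transitive M → ∀ w → T (sat M w (□ A ⇒ □ □ A))
  sat-4 A trans′ w = ⇒ᵇ-intro (sat M w (□ A)) λ □a →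
    □-sat⁺ (□ A) λ m → □-sat⁺ A λ m′ → □-sat⁻ A □a (trans′ m m′)

  sat-Löb : ∀ A → Transitive M → ConverseWellFounded M → ∀ w → T (sat M w (□ (□ A ⇒ A) ⇒ □ A))
  sat-Löb A trans′ wf w = ⇒ᵇ-intro (sat M w (□ (□ A ⇒ A))) (löb (wf w))
    where
    löb : ∀ {w} → Acc (λ v w → v ∈ successors M w) w → T (sat M w (□ (□ A ⇒ A))) → T (sat M w (□ A))
    löb (acc rs) h = □-sat⁺ A λ m →
      ⇒ᵇ-elim (sat M _ (□ A)) (□-sat⁻ (□ A ⇒ A) h m)
        (löb (rs m) (□-sat⁺ (□ A ⇒ A) λ m′ → □-sat⁻ (□ A ⇒ A) h (trans′ m m′)))

module _ {L : Logic} {M : Model} (ℳ : IsModelOf L M) where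
  open IsModelOf ℳ
  open Box M

  sound-Ax : Ax L A → ∀ w → T (sat M w A)
  sound-Ax (axD-D A)   = sat-D M A (serial tt)
  sound-Ax (axD-KD4 A) = sat-D M A (serial tt)
  sound-Ax (ax4-KD4 A) = sat-4 M A (transitive tt)
  sound-Ax (axT-KT A)  = sat-T M A (reflexive tt)
  sound-Ax (ax4-K4 A)  = sat-4 M A (transitive tt)
  sound-Ax (axT-S4 A)  = sat-T M A (reflexive tt)
  sound-Ax (ax4-S4 A)  = sat-4 M A (transitive tt)
  sound-Ax (axL-GL A)  = sat-Löb M A (transitive tt) (converseWF tt)

  sound : L ⊢ A → ∀ w → T (sat M w A)
  sound {A} (taut t) w = Equivalence.from T-≡ (trans (sat-evalB M w A) (t _ _))
  sound (axK A B) w = ⇒ᵇ-intro (sat M w (□ (A ⇒ B))) λ □ab → ⇒ᵇ-intro (sat M w (□ A)) λ □a →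
    □-sat⁺ B λ m → ⇒ᵇ-elim (sat M _ A) (□-sat⁻ (A ⇒ B) □ab m) (□-sat⁻ A □a m)
  sound (ax a)    = sound-Ax a
  sound (mp {φ = A} d e) w = ⇒ᵇ-elim (sat M w A) (sound d w) (sound e w)
  sound (nec {φ = A} d) w = □-sat⁺ A λ _ → sound d _

-- Hintikka types over a list of primes

primes : Fm → List Fm
primes (var n)  = var n ∷ []
primes ⊤ᶠ       = []
primes ⊥ᶠ       = []
primes (A ∧ᶠ B) = primes A ++ primes B
primes (A ∨ᶠ B) = primes A ++ primes B
primes (A ⇒ B)  = primes A ++ primes B
primes (□ A)    = □ A ∷ primes A

BoolComb : List Fm → Fm → Set
BoolComb P (var n)  = var n ∈ P
BoolComb P ⊤ᶠ       = ⊤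
BoolComb P ⊥ᶠ       = ⊤
BoolComb P (A ∧ᶠ B) = BoolComb P A × BoolComb P B
BoolComb P (A ∨ᶠ B) = BoolComb P A × BoolComb P B
BoolComb P (A ⇒ B)  = BoolComb P A × BoolComb P B
BoolComb P (□ A)    = □ A ∈ P

BoxClosed : List Fm → Set
BoxClosed P = ∀ {A} → □ A ∈ P → BoolComb P A

BoolComb-mono : P ⊆ Q → ∀ A → BoolComb P A → BoolComb Q A
BoolComb-mono P⊆Q (var n)  c       = P⊆Q c
BoolComb-mono P⊆Q ⊤ᶠ       _       = tt
BoolComb-mono P⊆Q ⊥ᶠ       _       = tt
BoolComb-mono P⊆Q (A ∧ᶠ B) (a , b) = BoolComb-mono P⊆Q A a , BoolComb-mono P⊆Q B b
BoolComb-mono P⊆Q (A ∨ᶠ B) (a , b) = BoolComb-mono P⊆Q A a , BoolComb-mono P⊆Q B b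
BoolComb-mono P⊆Q (A ⇒ B)  (a , b) = BoolComb-mono P⊆Q A a , BoolComb-mono P⊆Q B b
BoolComb-mono P⊆Q (□ A)    c       = P⊆Q c

BoolComb-primes : ∀ A → BoolComb (primes A) A
BoolComb-primes (var n)  = here refl
BoolComb-primes ⊤ᶠ       = tt
BoolComb-primes ⊥ᶠ       = tt
BoolComb-primes (A ∧ᶠ B) = BoolComb-mono ∈-++⁺ˡ A (BoolComb-primes A) , BoolComb-mono (∈-++⁺ʳ _) B (BoolComb-primes B)
BoolComb-primes (A ∨ᶠ B) = BoolComb-mono ∈-++⁺ˡ A (BoolComb-primes A) , BoolComb-mono (∈-++⁺ʳ _) B (BoolComb-primes B)
BoolComb-primes (A ⇒ B)  = BoolComb-mono ∈-++⁺ˡ A (BoolComb-primes A) , BoolComb-mono (∈-++⁺ʳ _) B (BoolComb-primes B)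
BoolComb-primes (□ A)    = here refl

++-closed : ∀ P → BoxClosed P → BoxClosed Q → BoxClosed (P ++ Q)
++-closed P cP cQ m with ∈-++⁻ P m
... | inj₁ m′ = BoolComb-mono ∈-++⁺ˡ _ (cP m′)
... | inj₂ m′ = BoolComb-mono (∈-++⁺ʳ P) _ (cQ m′)

primes-closed : ∀ A → BoxClosed (primes A)
primes-closed (var n) (here ())
primes-closed (var n) (there ())
primes-closed (A ∧ᶠ B) = ++-closed (primes A) (primes-closed A) (primes-closed B)
primes-closed (A ∨ᶠ B) = ++-closed (primes A) (primes-closed A) (primes-closed B)
primes-closed (A ⇒ B)  = ++-closed (primes A) (primes-closed A) (primes-closed B)
primes-closed (□ A) (here refl) = BoolComb-mono there A (BoolComb-primes A)
primes-closed (□ A) (there m)   = BoolComb-mono there _ (primes-closed A m)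

-- A type assigns truth values to primes; only its values on the primes in P matter.
Ty : Set
Ty = Fm → Bool

private variable
  t : Ty

ev : Ty → Fm → Bool
ev t = evalB (t ∘ var) (t ∘ □_)

Agree : (Fm → Bool) → List Fm → Ty → Set
Agree h P t = ∀ {p} → p ∈ P → h p ≡ t p

evalB-agree : ∀ {t} → Agree (evalB f g) P t → ∀ A → BoolComb P A → evalB f g A ≡ ev t A
evalB-agree ag (var n)  c       = ag c
evalB-agree ag ⊤ᶠ       _       = refl
evalB-agree ag ⊥ᶠ       _       = refl
evalB-agree ag (A ∧ᶠ B) (a , b) = cong₂ _∧_ (evalB-agree ag A a) (evalB-agree ag B b)
evalB-agree ag (A ∨ᶠ B) (a , b) = cong₂ _∨_ (evalB-agree ag A a) (evalB-agree ag B b)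
evalB-agree ag (A ⇒ B)  (a , b) = cong₂ _⇒ᵇ_ (evalB-agree ag A a) (evalB-agree ag B b)
evalB-agree ag (□ A)    c       = ag c

sat-agree : ∀ {M w t} → Agree (sat M w) P t → ∀ A → BoolComb P A → sat M w A ≡ ev t A
sat-agree {M = M} {w} ag A c = trans (sat-evalB M w A) (evalB-agree (λ {p} m → trans (sym (sat-evalB M w p)) (ag m)) A c)

lit : Fm → Bool → Fm
lit A true  = A
lit A false = ¬ᶠ A

char : List Fm → Ty → Fm
char P t = ⋀ (map (λ p → lit p (t p)) P)

lit-holds⁻ : ∀ b → Holds f g (lit A b) → evalB f g A ≡ b
lit-holds⁻ true h = Equivalence.to T-≡ h
lit-holds⁻ {f = f} {g} {A} false h with evalB f g A
... | false = refl

lit-holds⁺ : ∀ b → evalB f g A ≡ b → Holds f g (lit A b)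
lit-holds⁺ true  e = subst T (sym e) tt
lit-holds⁺ false e = subst (λ a → T (a ⇒ᵇ false)) (sym e) tt

char-holds⁻ : ∀ {t} → Holds f g (char P t) → Agree (evalB f g) P t
char-holds⁻ {P = P} h m = lit-holds⁻ _ (All.lookup (Allₚ.map⁻ (⋀-holds⁻ (map _ P) h)) m)

char-holds⁺ : ∀ {t} → Agree (evalB f g) P t → Holds f g (char P t)
char-holds⁺ ag = ⋀-holds⁺ (Allₚ.map⁺ (All.tabulate λ m → lit-holds⁺ _ (ag m)))

module _ {M : Model} {w : W M} where

  sat-char⁺ : Agree (sat M w) P t → T (sat M w (char P t))
  sat-char⁺ {P} {t} ag = subst T (sym (sat-evalB M w (char P t))) (char-holds⁺ λ {p} m → trans (sym (sat-evalB M w p)) (ag m))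

  sat-char⁻ : T (sat M w (char P t)) → Agree (sat M w) P t
  sat-char⁻ {P} {t} h {p} m = trans (sat-evalB M w p) (char-holds⁻ (subst T (sat-evalB M w (char P t)) h) m)

module _ (t : Ty) where

  char⇒ : ∀ A → BoolComb P A → T (ev t A) → L ⊢ char P t ⇒ A
  char⇒ {P} A c e = ⊢-consequence [] λ f g _ →
    ⇒ᵇ-intro (evalB f g (char P t)) λ h → subst T (sym (evalB-agree (char-holds⁻ h) A c)) e

  char⇒¬ : ∀ A → BoolComb P A → ¬ T (ev t A) → L ⊢ char P t ⇒ ¬ᶠ A
  char⇒¬ {P} A c e = ⊢-consequence [] λ f g _ →
    ⇒ᵇ-intro (evalB f g (char P t)) λ h → ¬ᵇ-intro (evalB f g A) (e ∘ subst T (evalB-agree (char-holds⁻ h) A c))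

infix 4 _==_
_==_ : Fm → Fm → Bool
var m    == var n    = m ≡ᵇ n
⊤ᶠ       == ⊤ᶠ       = true
⊥ᶠ       == ⊥ᶠ       = true
(A ∧ᶠ B) == (C ∧ᶠ E) = (A == C) ∧ (B == E)
(A ∨ᶠ B) == (C ∨ᶠ E) = (A == C) ∧ (B == E)
(A ⇒ B)  == (C ⇒ E)  = (A == C) ∧ (B == E)
(□ A)    == (□ C)    = A == C
_        == _        = false

==⇒≡ : ∀ A B → T (A == B) → A ≡ B
==⇒≡ (var m)  (var n)  e = cong var (≡ᵇ⇒≡ m n e)
==⇒≡ ⊤ᶠ       ⊤ᶠ       _ = refl
==⇒≡ ⊥ᶠ       ⊥ᶠ       _ = refl
==⇒≡ (A ∧ᶠ B) (C ∧ᶠ E) e = let a , b = ∧ᵇ-elim {A == C} e in cong₂ _∧ᶠ_ (==⇒≡ A C a) (==⇒≡ B E b)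
==⇒≡ (A ∨ᶠ B) (C ∨ᶠ E) e = let a , b = ∧ᵇ-elim {A == C} e in cong₂ _∨ᶠ_ (==⇒≡ A C a) (==⇒≡ B E b)
==⇒≡ (A ⇒ B)  (C ⇒ E)  e = let a , b = ∧ᵇ-elim {A == C} e in cong₂ _⇒_ (==⇒≡ A C a) (==⇒≡ B E b)
==⇒≡ (□ A)    (□ C)    e = cong □_ (==⇒≡ A C e)

==-refl : ∀ A → T (A == A)
==-refl (var n)  = ≡⇒≡ᵇ n n refl
==-refl ⊤ᶠ       = tt
==-refl ⊥ᶠ       = tt
==-refl (A ∧ᶠ B) = ∧ᵇ-intro (==-refl A) (==-refl B)
==-refl (A ∨ᶠ B) = ∧ᵇ-intro (==-refl A) (==-refl B)
==-refl (A ⇒ B)  = ∧ᵇ-intro (==-refl A) (==-refl B)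
==-refl (□ A)    = ==-refl A

_[_≔_] : Ty → Fm → Bool → Ty
(t [ p ≔ b ]) q = if q == p then b else t q

types : List Fm → List Ty
types []      = (λ _ → false) ∷ []
types (p ∷ P) = map (_[ p ≔ true ]) (types P) ++ map (_[ p ≔ false ]) (types P)

∈-types-≔ : ∀ {p t} P → t ∈ types P → ∀ b → t [ p ≔ b ] ∈ types (p ∷ P)
∈-types-≔ _ m true  = ∈-++⁺ˡ (∈-map⁺ _ m)
∈-types-≔ _ m false = ∈-++⁺ʳ _ (∈-map⁺ _ m)

types-complete : ∀ P (h : Fm → Bool) → ∃[ t ] t ∈ types P × Agree h P t
types-complete []      h = _ , here refl , λ ()
types-complete (p ∷ P) h =
  let t , m , ag = types-complete P h in t [ p ≔ h p ] , ∈-types-≔ P m (h p) , agree t ag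
  where
  agree : ∀ t → Agree h P t → Agree h (p ∷ P) (t [ p ≔ h p ])
  agree t ag {q} m with q == p in eq | m
  ... | true  | _         = cong h (==⇒≡ q p (subst T (sym eq) tt))
  ... | false | here refl = ⊥-elim (subst T eq (==-refl p))
  ... | false | there m′  = ag m′

⋁char : List Fm → List Ty → Fm
⋁char P S = ⋁ (map (char P) S)

⋁char-holds⁻ : ∀ {S} → Holds f g (⋁char P S) → ∃[ s ] s ∈ S × Agree (evalB f g) P s
⋁char-holds⁻ {P = P} {S} h =
  let s , m , hs = find (Anyₚ.map⁻ (⋁-holds⁻ (map (char P) S) h)) in s , m , char-holds⁻ hs

⊢-⋁char-types : ∀ P → L ⊢ ⋁char P (types P)
⊢-⋁char-types P = ⊢-consequence [] λ f g _ →
  let t , m , ag = types-complete P (evalB f g) in ⋁-holds⁺ (Anyₚ.map⁺ (lose m (char-holds⁺ ag)))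

-- Elimination of Hintikka types

unbox : Fm → List Fm
unbox (□ A) = A ∷ []
unbox _     = []

unbox-□ : ∀ B → A ∈ unbox B → B ≡ □ A
unbox-□ (□ _) (here refl) = refl

module Elimination (L : Logic) (P : List Fm) (closed : BoxClosed P) where

  boxed : List Fm
  boxed = concatMap unbox P

  ∈-boxed⁺ : □ A ∈ P → A ∈ boxed
  ∈-boxed⁺ m = ∈-concat⁺′ (here refl) (∈-map⁺ unbox m)

  ∈-boxed⁻ : A ∈ boxed → □ A ∈ P
  ∈-boxed⁻ m with ∈-concat⁻′ (map unbox P) m
  ... | _ , k , n with ∈-map⁻ unbox n
  ... | B , mB , refl = subst (_∈ P) (unbox-□ B k) mB

  boxContent : Ty → List Fm
  boxContent t = filterᵇ (t ∘ □_) boxed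

  ∈-boxContent⁺ : ∀ t → □ A ∈ P → T (t (□ A)) → A ∈ boxContent t
  ∈-boxContent⁺ t m = ∈-filter⁺ (T? ∘ t ∘ □_) (∈-boxed⁺ m)

  ∈-boxContent⁻ : ∀ t → A ∈ boxContent t → □ A ∈ P × T (t (□ A))
  ∈-boxContent⁻ t m = let k , e = ∈-filter⁻ (T? ∘ t ∘ □_) m in ∈-boxed⁻ k , e

  boxesIf : Bool → List Fm → List Fm
  boxesIf true  As = map □_ As
  boxesIf false _  = []

  forced : Ty → List Fm
  forced t = boxContent t ++ boxesIf (isTransitive L) (boxContent t)

  ∈-forced⁺ : ∀ t → A ∈ boxContent t → A ∈ forced t
  ∈-forced⁺ t = ∈-++⁺ˡ

  ∈-forced-□⁺ : ∀ t → T (isTransitive L) → A ∈ boxContent t → □ A ∈ forced t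
  ∈-forced-□⁺ t tr m = ∈-++⁺ʳ (boxContent t) (boxes tr m)
    where
    boxes : ∀ {b As} → T b → A ∈ As → □ A ∈ boxesIf b As
    boxes {b = true} _ = ∈-map⁺ □_

  ∈-forced⁻ : ∀ t → X ∈ forced t →
              X ∈ boxContent t ⊎ (T (isTransitive L) × ∃[ A ] A ∈ boxContent t × X ≡ □ A)
  ∈-forced⁻ t m with ∈-++⁻ (boxContent t) m
  ... | inj₁ k = inj₁ k
  ... | inj₂ k = inj₂ (boxes (isTransitive L) k)
    where
    boxes : ∀ b {As} → X ∈ boxesIf b As → T b × ∃[ A ] A ∈ As × X ≡ □ A
    boxes true k = tt , ∈-map⁻ □_ k

  forced-BoolComb : ∀ t → X ∈ forced t → BoolComb P X
  forced-BoolComb t m with ∈-forced⁻ t m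
  ... | inj₁ k                  = closed (proj₁ (∈-boxContent⁻ t k))
  ... | inj₂ (_ , _ , k , refl) = proj₁ (∈-boxContent⁻ t k)

  grows : Ty → Ty → Bool
  grows t s = any (λ A → s (□ A) ∧ not (t (□ A))) boxed

  -- The accessibility relation of the canonical model; in GL it must be strict.
  infix 4 _⇝_
  _⇝_ : Ty → Ty → Bool
  t ⇝ s = all (ev s) (forced t) ∧ (hasLöb L ⇒ᵇ grows t s)

  coherent : Ty → Fm → Bool
  coherent t B = t (□ B) ⇒ᵇ (isReflexive L ⇒ᵇ ev t B)

  ◇-witnessed : List Ty → Ty → Fm → Bool
  ◇-witnessed S t B = t (□ B) ∨ any (λ s → (t ⇝ s) ∧ not (ev s B)) S

  good : List Ty → Ty → Bool
  good S t = all (coherent t) boxed ∧ all (◇-witnessed S t) boxed ∧ (isSerial L ⇒ᵇ any (t ⇝_) S)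

  good-elim : ∀ S t → T (good S t) →
              T (all (coherent t) boxed) × T (all (◇-witnessed S t) boxed) × T (isSerial L ⇒ᵇ any (t ⇝_) S)
  good-elim S t g = let c , w∧s = ∧ᵇ-elim g in c , ∧ᵇ-elim {all (◇-witnessed S t) boxed} w∧s

  char⇒□forced : ∀ t → L ⊢ char P t ⇒ □ ⋀ (forced t)
  char⇒□forced t = □-⋀-intro (forced t) λ m → char⇒□ (∈-forced⁻ t m)
    where
    char⇒□ : X ∈ boxContent t ⊎ (T (isTransitive L) × ∃[ A ] A ∈ boxContent t × X ≡ □ A) → L ⊢ char P t ⇒ □ X
    char⇒□ {X} (inj₁ k) = let □X∈P , tX = ∈-boxContent⁻ t k in char⇒ t (□ X) □X∈P tX
    char⇒□ (inj₂ (tr , A , k , refl)) =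
      let □A∈P , tA = ∈-boxContent⁻ t k in ⇒-trans (char⇒ t (□ A) □A∈P tA) (⊢-4 tr)

  module Refutation (S : List Ty) (cov : L ⊢ ⋁char P S) where

    forced-successor : ∀ {f g} t → Holds f g (⋁char P S) → Holds f g (⋀ (forced t)) →
                       (T (hasLöb L) → ∃[ A ] A ∈ boxed × T (g A) × ¬ T (t (□ A))) →
                       ∃[ s ] s ∈ S × Agree (evalB f g) P s × T (t ⇝ s)
    forced-successor t h hf gr =
      let s , m , ag = ⋁char-holds⁻ h in
      s , m , ag ,
      ∧ᵇ-intro (all⁻ _ (All.tabulate λ {X} k →
                 subst T (evalB-agree ag X (forced-BoolComb t k)) (All.lookup (⋀-holds⁻ _ hf) k)))
               (⇒ᵇ-intro (hasLöb L) λ l → let A , k , gA , ¬tA = gr l in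
                 any⁺ _ (lose k (∧ᵇ-intro (subst T (ag (∈-boxed⁻ k)) gA) (T-not ¬tA))))

    refute-coherent : ∀ {t} → B ∈ boxed → ¬ T (coherent t B) → L ⊢ char P t ⇒ ⊥ᶠ
    refute-coherent {B} {t} mB ¬c =
      let □B , ¬c′ = ⇒ᵇ-counter (t (□ B)) ¬c ; r , ¬B = ⇒ᵇ-counter (isReflexive L) ¬c′ in
      ⇒-contradiction (⇒-trans (char⇒ t (□ B) (∈-boxed⁻ mB) □B) (⊢-T r)) (char⇒¬ t B (closed (∈-boxed⁻ mB)) ¬B)

    B-at-successors : ∀ {f g} t → B ∈ boxed → ¬ T (t (□ B)) → ¬ T (any (λ s → (t ⇝ s) ∧ not (ev s B)) S) →
                      Holds f g (⋁char P S) → Holds f g (⋀ (forced t)) → (T (hasLöb L) → T (g B)) → Holds f g B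
    B-at-successors {B} t mB ¬□B none h hf gB =
      let s , m , ag , r = forced-successor t h hf (λ l → B , mB , gB l , ¬□B) in
      subst T (sym (evalB-agree ag B (closed (∈-boxed⁻ mB)))) (∧-not r (none ∘ any⁺ _ ∘ lose m))

    -- In GL the successor must also be strictly above t, which needs □B; Löb's axiom supplies it.
    refute-◇ : ∀ {t} → B ∈ boxed → ¬ T (◇-witnessed S t B) → L ⊢ char P t ⇒ ⊥ᶠ
    refute-◇ {B} {t} mB ¬w with ∨ᵇ-counter (t (□ B)) ¬w | T? (hasLöb L)
    ... | ¬□B , none | no ¬löb =
      ⇒-contradiction (⇒-trans (char⇒□forced t) (□-mono forced⇒B)) (char⇒¬ t (□ B) (∈-boxed⁻ mB) ¬□B)
      where
      forced⇒B : L ⊢ ⋀ (forced t) ⇒ B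
      forced⇒B = ⊢-consequence (cov ∷ []) λ f g (h , _) → ⇒ᵇ-intro (evalB f g (⋀ (forced t))) λ hf →
        B-at-successors t mB ¬□B none h hf (⊥-elim ∘ ¬löb)
    ... | ¬□B , none | yes löb =
      ⇒-contradiction (⇒-trans (char⇒□forced t) (⇒-trans (□-mono forced⇒□B⇒B) (⊢-Löb löb)))
                      (char⇒¬ t (□ B) (∈-boxed⁻ mB) ¬□B)
      where
      forced⇒□B⇒B : L ⊢ ⋀ (forced t) ⇒ □ B ⇒ B
      forced⇒□B⇒B = ⊢-consequence (cov ∷ []) λ f g (h , _) → ⇒ᵇ-intro (evalB f g (⋀ (forced t))) λ hf →
        ⇒ᵇ-intro (g B) λ gB → B-at-successors t mB ¬□B none h hf λ _ → gB

    refute-serial : ∀ {t} → T (isSerial L) → ¬ T (any (t ⇝_) S) → L ⊢ char P t ⇒ ⊥ᶠ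
    refute-serial {t} ser none = ⇒-trans (char⇒□forced t) (⇒-trans (□-mono forced⇒⊥) (⊢-D ser))
      where
      forced⇒⊥ : L ⊢ ⋀ (forced t) ⇒ ⊥ᶠ
      forced⇒⊥ = ⊢-consequence (cov ∷ []) λ f g (h , _) → ⇒ᵇ-intro (evalB f g (⋀ (forced t))) λ hf →
        let _ , m , _ , r = forced-successor t h hf (⊥-elim ∘ serial⇒¬Löb ser) in none (any⁺ _ (lose m r))

    refute : ∀ {t} → ¬ T (good S t) → L ⊢ char P t ⇒ ⊥ᶠ
    refute {t} ¬good with T? (all (coherent t) boxed) | T? (all (◇-witnessed S t) boxed)
    ... | no ¬c | _ = let B , mB , ¬cB = ¬all⇒any¬ (coherent t) boxed ¬c in refute-coherent mB ¬cB
    ... | yes _ | no ¬w = let B , mB , ¬wB = ¬all⇒any¬ (◇-witnessed S t) boxed ¬w in refute-◇ mB ¬wB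
    ... | yes c | yes w =
      let ser , none = ⇒ᵇ-counter (isSerial L) (¬good ∘ ∧ᵇ-intro c ∘ ∧ᵇ-intro w) in refute-serial ser none

  prune : ∀ S → L ⊢ ⋁char P S → L ⊢ ⋁char P (filterᵇ (good S) S)
  prune S cov = mp (⋁-elim (char P) S keep) cov
    where
    keep : ∀ {t} → t ∈ S → L ⊢ char P t ⇒ ⋁char P (filterᵇ (good S) S)
    keep {t} m with T? (good S t)
    ... | yes g  = ⋁-intro (char P) (∈-filter⁺ (T? ∘ good S) m g)
    ... | no ¬g = ⇒-⊥-elim (Refutation.refute S cov ¬g)

  eliminate : ∀ S → Acc _<_ (length S) → L ⊢ ⋁char P S → ∃[ S′ ] (L ⊢ ⋁char P S′) × All (T ∘ good S′) S′
  eliminate S (acc rs) cov with all? (T? ∘ good S) S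
  ... | yes gs = S , cov , gs
  ... | no ¬gs = eliminate (filterᵇ (good S) S) (rs shorter) (prune S cov)
    where
    shorter : length (filterᵇ (good S) S) < length S
    shorter = filter-notAll (T? ∘ good S) S (¬All⇒Any¬ (T? ∘ good S) S ¬gs)

  boxContent-mono : ∀ t s → T (isTransitive L) → T (t ⇝ s) → boxContent t ⊆ boxContent s
  boxContent-mono t s tr r k =
    ∈-boxContent⁺ s (proj₁ (∈-boxContent⁻ t k))
      (All.lookup (all⁺ _ _ (proj₁ (∧ᵇ-elim r))) (∈-forced-□⁺ t tr k))

  forced-mono : ∀ t s → T (isTransitive L) → T (t ⇝ s) → forced t ⊆ forced s
  forced-mono t s tr r m with ∈-forced⁻ t m
  ... | inj₁ k                  = ∈-forced⁺ s (boxContent-mono t s tr r k)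
  ... | inj₂ (_ , _ , k , refl) = ∈-forced-□⁺ s tr (boxContent-mono t s tr r k)

  grows-witness : ∀ t s → T (hasLöb L) → T (t ⇝ s) → ∃[ A ] A ∈ boxed × T (s (□ A)) × ¬ T (t (□ A))
  grows-witness t s l r =
    let A , mA , h = find (any⁻ _ _ (⇒ᵇ-elim (hasLöb L) (proj₂ (∧ᵇ-elim {all (ev s) (forced t)} r)) l))
        sA , ¬tA = ∧ᵇ-elim h
    in A , mA , sA , ¬T-not ¬tA

  ⇝-trans : ∀ {t s u} → T (isTransitive L) → T (t ⇝ s) → T (s ⇝ u) → T (t ⇝ u)
  ⇝-trans {t} {s} {u} tr r r′ =
    ∧ᵇ-intro (all-anti-mono (ev u) (forced-mono t s tr r) (proj₁ (∧ᵇ-elim r′)))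
             (⇒ᵇ-intro (hasLöb L) λ l → let A , mA , sA , ¬tA = grows-witness t s l r in
               let uA = boxContent-mono s u tr r′ (∈-boxContent⁺ s (∈-boxed⁻ mA) sA) in
               any⁺ _ (lose mA (∧ᵇ-intro (proj₂ (∈-boxContent⁻ u uA)) (T-not ¬tA))))

  ⇝-refl : ∀ {t} → T (isReflexive L) → (∀ {B} → B ∈ boxed → T (coherent t B)) → T (t ⇝ t)
  ⇝-refl {t} rf coh =
    ∧ᵇ-intro (all⁻ _ (All.tabulate forced-at-t)) (⇒ᵇ-intro (hasLöb L) (⊥-elim ∘ reflexive⇒¬Löb rf))
    where
    forced-at-t : X ∈ forced t → T (ev t X)
    forced-at-t m with ∈-forced⁻ t m
    ... | inj₁ k = let □A∈P , tA = ∈-boxContent⁻ t k in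
                   ⇒ᵇ-elim (isReflexive L) (⇒ᵇ-elim (t (□ _)) (coh (∈-boxed⁺ □A∈P)) tA) rf
    ... | inj₂ (_ , _ , k , refl) = proj₂ (∈-boxContent⁻ t k)

  rank : Ty → ℕ
  rank t = length (boxContent t)

  ⇝-rank : ∀ {t s} → T (hasLöb L) → T (t ⇝ s) → rank t < rank s
  ⇝-rank {t} {s} l r =
    let A , mA , sA , ¬tA = grows-witness t s l r in
    length-filterᵇ-< boxed (λ k tB → proj₂ (∈-boxContent⁻ s (mono (∈-boxContent⁺ t (∈-boxed⁻ k) tB)))) mA sA ¬tA
    where
    mono : boxContent t ⊆ boxContent s
    mono = boxContent-mono t s (Löb⇒transitive l) r

  module Canonical (S : List Ty) (good-S : All (T ∘ good S) S) where

    world : Fin (length S) → Ty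
    world = lookup S

    M : Model
    M = record
      { W          = Fin (length S)
      ; successors = λ i → filterᵇ (λ j → world i ⇝ world j) (allFin _)
      ; val        = λ i n → world i (var n)
      }
    open Box M

    ∈-successors⁺ : ∀ {i j} → T (world i ⇝ world j) → j ∈ successors M i
    ∈-successors⁺ {i} {j} = ∈-filter⁺ (λ j → T? (world i ⇝ world j)) (∈-allFin j)

    ∈-successors⁻ : ∀ {i j} → j ∈ successors M i → T (world i ⇝ world j)
    ∈-successors⁻ {i} = proj₂ ∘ ∈-filter⁻ (λ j → T? (world i ⇝ world j)) {xs = allFin _}

    world-index : ∀ {s} → s ∈ S → ∃[ j ] s ≡ world j
    world-index m = index m , lookup-index m

    good-world : ∀ i → T (good S (world i))
    good-world i = All.lookup good-S (∈-lookup i)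

    coherent-world : ∀ i → B ∈ boxed → T (coherent (world i) B)
    coherent-world i = All.lookup (all⁺ _ _ (proj₁ (good-elim S (world i) (good-world i))))

    ◇-witnessed-world : ∀ i → B ∈ boxed → T (◇-witnessed S (world i) B)
    ◇-witnessed-world i = All.lookup (all⁺ _ _ (proj₁ (proj₂ (good-elim S (world i) (good-world i)))))

    serial-world : ∀ i → T (isSerial L) → T (any (world i ⇝_) S)
    serial-world i = ⇒ᵇ-elim (isSerial L) (proj₂ (proj₂ (good-elim S (world i) (good-world i))))

    truth : ∀ A → BoolComb P A → ∀ i → sat M i A ≡ ev (world i) A
    truth (var n)  _       i = refl
    truth ⊤ᶠ       _       i = refl
    truth ⊥ᶠ       _       i = refl
    truth (A ∧ᶠ B) (a , b) i = cong₂ _∧_ (truth A a i) (truth B b i)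
    truth (A ∨ᶠ B) (a , b) i = cong₂ _∨_ (truth A a i) (truth B b i)
    truth (A ⇒ B)  (a , b) i = cong₂ _⇒ᵇ_ (truth A a i) (truth B b i)
    truth (□ A)    c       i = T-injective sat⇒ev ev⇒sat
      where
      refuting-successor : ¬ T (world i (□ A)) → ∃[ j ] j ∈ successors M i × ¬ T (ev (world j) A)
      refuting-successor ¬□A with ∨ᵇ-elim (◇-witnessed-world i (∈-boxed⁺ c))
      ... | inj₁ □A = ⊥-elim (¬□A □A)
      ... | inj₂ w with find (any⁻ _ S w)
      ...   | s , ms , r∧¬A with world-index ms
      ...     | j , refl = let r , ¬A = ∧ᵇ-elim r∧¬A in j , ∈-successors⁺ r , ¬T-not ¬A

      sat⇒ev : T (sat M i (□ A)) → T (world i (□ A))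
      sat⇒ev h with T? (world i (□ A))
      ... | yes □A = □A
      ... | no ¬□A = let j , m , ¬A = refuting-successor ¬□A in
                     ⊥-elim (¬A (subst T (truth A (closed c) j) (□-sat⁻ A h m)))

      ev⇒sat : T (world i (□ A)) → T (sat M i (□ A))
      ev⇒sat □A = □-sat⁺ A λ {j} m → subst T (sym (truth A (closed c) j))
        (All.lookup (all⁺ _ _ (proj₁ (∧ᵇ-elim (∈-successors⁻ m))))
                    (∈-forced⁺ (world i) (∈-boxContent⁺ (world i) c □A)))

    isModel : IsModelOf L M
    isModel = record
      { serial     = λ ser i → let s , ms , r = find (any⁻ _ S (serial-world i ser)) ; j , e = world-index ms in
                               j , ∈-successors⁺ (subst (T ∘ (world i ⇝_)) e r)
      ; reflexive  = λ rf i → ∈-successors⁺ (⇝-refl {world i} rf (coherent-world i))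
      ; transitive = λ tr {i} {j} {k} m m′ →
                       ∈-successors⁺ (⇝-trans {world i} {world j} {world k} tr (∈-successors⁻ m) (∈-successors⁻ m′))
      ; converseWF = λ l → Subrelation.wellFounded (decreasing l) (On.wellFounded measure <-wellFounded)
      }
      where
      measure : Fin (length S) → ℕ
      measure i = length boxed ∸ rank (world i)
      decreasing : T (hasLöb L) → ∀ {i j} → j ∈ successors M i → measure j < measure i
      decreasing l {i} {j} m = ∸-monoʳ-< (⇝-rank {world i} {world j} l (∈-successors⁻ m)) (length-filter _ boxed)

Countermodel : Logic → Fm → Set₁
Countermodel L χ = Σ Model λ M → IsModelOf L M × Σ (W M) λ w → ¬ T (sat M w χ)

decide : ∀ L χ → L ⊢ χ ⊎ Countermodel L χ
decide L χ = conclude (eliminate (types (primes χ)) (<-wellFounded _) (⊢-⋁char-types (primes χ)))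
  where
  open Elimination L (primes χ) (primes-closed χ)
  conclude : ∃[ S ] (L ⊢ ⋁char (primes χ) S) × All (T ∘ good S) S → L ⊢ χ ⊎ Countermodel L χ
  conclude (S , cov , good-S) with all? (λ s → T? (ev s χ)) S
  ... | yes χ-everywhere =
    inj₁ (mp (⋁-elim (char (primes χ)) S λ {s} m → char⇒ s χ (BoolComb-primes χ) (All.lookup χ-everywhere m)) cov)
  ... | no ¬χ-everywhere with find (¬All⇒Any¬ (λ s → T? (ev s χ)) S ¬χ-everywhere)
  ...   | s , m , ¬χ with Canonical.world-index S good-S m
  ...     | j , refl = inj₂ (M , isModel , j , ¬χ ∘ subst T (truth χ (BoolComb-primes χ) j))
    where open Canonical S good-S

infix 2 _⊢?_
_⊢?_ : ∀ L χ → Dec (L ⊢ χ)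
L ⊢? χ with decide L χ
... | inj₁ d = yes d
... | inj₂ (M , ℳ , w , ¬χ) = no λ d → ¬χ (sound ℳ d w)

completeness : ∀ {L χ} → (Countermodel L χ → ⊥) → L ⊢ χ
completeness {L} {χ} no-countermodel with decide L χ
... | inj₁ d = d
... | inj₂ c = ⊥-elim (no-countermodel c)

-- Gluing countermodels below a common root

record Embedding (M N : Model) : Set where
  field
    embed            : W M → W N
    successors-embed : ∀ v → successors N (embed v) ≡ map embed (successors M v)
    val-embed        : ∀ v → val N (embed v) ≡ val M v

module _ {M N : Model} (e : Embedding M N) where
  open Embedding e

  sat-embed : ∀ A v → sat N (embed v) A ≡ sat M v A
  sat-embed (var n)  v = cong (λ f → f n) (val-embed v)
  sat-embed ⊤ᶠ       v = refl
  sat-embed ⊥ᶠ       v = refl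
  sat-embed (A ∧ᶠ B) v = cong₂ _∧_ (sat-embed A v) (sat-embed B v)
  sat-embed (A ∨ᶠ B) v = cong₂ _∨_ (sat-embed A v) (sat-embed B v)
  sat-embed (A ⇒ B)  v = cong₂ _⇒ᵇ_ (sat-embed A v) (sat-embed B v)
  sat-embed (□ A)    v = begin
    all (λ u → sat N u A) (successors N (embed v))            ≡⟨ cong (all _) (successors-embed v) ⟩
    and (map (λ u → sat N u A) (map embed (successors M v)))  ≡⟨ cong and (sym (map-∘ (successors M v))) ⟩
    all (λ u → sat N (embed u) A) (successors M v)            ≡⟨ cong and (map-cong (sat-embed A) (successors M v)) ⟩
    all (λ u → sat M u A) (successors M v)                    ∎
    where open ≡-Reasoning

  ∈-embed⁺ : ∀ {v u} → u ∈ successors M v → embed u ∈ successors N (embed v)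
  ∈-embed⁺ {v} m = subst (_ ∈_) (sym (successors-embed v)) (∈-map⁺ embed m)

  ∈-embed⁻ : ∀ {v x} → x ∈ successors N (embed v) → ∃[ u ] u ∈ successors M v × x ≡ embed u
  ∈-embed⁻ {v} m = ∈-map⁻ embed (subst (_ ∈_) (successors-embed v) m)

  serial-embed : Serial M → ∀ v → ∃[ x ] x ∈ successors N (embed v)
  serial-embed ser v = let u , m = ser v in embed u , ∈-embed⁺ m

  reflexive-embed : Reflexive M → ∀ v → embed v ∈ successors N (embed v)
  reflexive-embed rf v = ∈-embed⁺ (rf v)

  transitive-embed : Transitive M → ∀ {v x y} →
                     x ∈ successors N (embed v) → y ∈ successors N x → y ∈ successors N (embed v)
  transitive-embed tr m m′ with ∈-embed⁻ m
  ... | u , k , refl with ∈-embed⁻ m′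
  ...   | u′ , k′ , refl = ∈-embed⁺ (tr k k′)

  acc-embed : ∀ {v} → Acc (λ u v → u ∈ successors M v) v → Acc (λ x y → x ∈ successors N y) (embed v)
  acc-embed (acc rs) = acc λ m → let u , k , e = ∈-embed⁻ m in subst (Acc _) (sym e) (acc-embed (rs k))

infixr 5 _⊕_
_⊕_ : Model → Model → Model
M₁ ⊕ M₂ = record
  { W          = W M₁ ⊎ W M₂
  ; successors = [ map inj₁ ∘ successors M₁ , map inj₂ ∘ successors M₂ ]
  ; val        = [ val M₁ , val M₂ ]
  }

inj₁-embedding : ∀ {M₁ M₂} → Embedding M₁ (M₁ ⊕ M₂)
inj₁-embedding = record { embed = inj₁ ; successors-embed = λ _ → refl ; val-embed = λ _ → refl }

inj₂-embedding : ∀ {M₁ M₂} → Embedding M₂ (M₁ ⊕ M₂)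
inj₂-embedding = record { embed = inj₂ ; successors-embed = λ _ → refl ; val-embed = λ _ → refl }

⊕-isModel : ∀ {M₁ M₂} → IsModelOf L M₁ → IsModelOf L M₂ → IsModelOf L (M₁ ⊕ M₂)
⊕-isModel {M₁ = M₁} {M₂} ℳ₁ ℳ₂ = record
  { serial     = λ s → [ serial-embed e₁ (serial ℳ₁ s) , serial-embed e₂ (serial ℳ₂ s) ]
  ; reflexive  = λ r → [ reflexive-embed e₁ (reflexive ℳ₁ r) , reflexive-embed e₂ (reflexive ℳ₂ r) ]
  ; transitive = transitive′
  ; converseWF = λ l → [ (λ v → acc-embed e₁ (converseWF ℳ₁ l v)) , (λ v → acc-embed e₂ (converseWF ℳ₂ l v)) ]
  }
  where
  open IsModelOf
  e₁ : Embedding M₁ (M₁ ⊕ M₂)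
  e₁ = inj₁-embedding
  e₂ : Embedding M₂ (M₁ ⊕ M₂)
  e₂ = inj₂-embedding
  transitive′ : T (isTransitive _) → Transitive (M₁ ⊕ M₂)
  transitive′ t {inj₁ v} {x} {y} = transitive-embed e₁ (transitive ℳ₁ t) {v} {x} {y}
  transitive′ t {inj₂ v} {x} {y} = transitive-embed e₂ (transitive ℳ₂ t) {v} {x} {y}

module Rooted (L : Logic) (M : Model) (children : List (W M)) (ρ : ℕ → Bool) where

  loop : List (Maybe (W M))
  loop = if isReflexive L then nothing ∷ [] else []

  ∈-loop⁺ : T (isReflexive L) → nothing ∈ loop
  ∈-loop⁺ r with isReflexive L
  ... | true = here refl

  ∈-loop⁻ : ∀ {x} → x ∈ loop → T (isReflexive L) × x ≡ nothing
  ∈-loop⁻ m with isReflexive L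
  ∈-loop⁻ (here refl) | true = tt , refl

  next : Maybe (W M) → List (Maybe (W M))
  next nothing  = loop ++ map just children
  next (just v) = map just (successors M v)

  N : Model
  N = record { W = Maybe (W M) ; successors = next ; val = maybe (val M) ρ }
  open Box N

  just-embedding : Embedding M N
  just-embedding = record { embed = just ; successors-embed = λ _ → refl ; val-embed = λ _ → refl }

  ∈-root⁺ : ∀ {v} → v ∈ children → just v ∈ next nothing
  ∈-root⁺ m = ∈-++⁺ʳ loop (∈-map⁺ just m)

  root-□⁻ : ∀ B → T (sat N nothing (□ B)) → ∀ {v} → v ∈ children → T (sat M v B)
  root-□⁻ B h {v} m = subst T (sat-embed just-embedding B v) (□-sat⁻ {nothing} B h (∈-root⁺ m))

  root-□⁺ : ∀ B → (T (isReflexive L) → T (sat N nothing B)) → (∀ {v} → v ∈ children → T (sat M v B)) →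
            T (sat N nothing (□ B))
  root-□⁺ B here′ children′ = □-sat⁺ {nothing} B λ m → at (∈-++⁻ loop m)
    where
    at : ∀ {x} → x ∈ loop ⊎ x ∈ map just children → T (sat N x B)
    at (inj₁ k) with ∈-loop⁻ k
    ... | r , refl = here′ r
    at (inj₂ k) with ∈-map⁻ just k
    ... | v , mv , refl = subst T (sym (sat-embed just-embedding B v)) (children′ mv)

  isModel : IsModelOf L M → (T (isSerial L) → ∃[ v ] v ∈ children) →
            (T (isTransitive L) → ∀ {v u} → v ∈ children → u ∈ successors M v → u ∈ children) → IsModelOf L N
  isModel ℳ nonempty upward = record
    { serial     = λ s → λ { nothing → let v , m = nonempty s in just v , ∈-root⁺ m
                           ; (just v) → serial-embed just-embedding (serial ℳ s) v }
    ; reflexive  = λ r → λ { nothing → ∈-++⁺ˡ (∈-loop⁺ r)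
                           ; (just v) → reflexive-embed just-embedding (reflexive ℳ r) v }
    ; transitive = transitive′
    ; converseWF = λ l → λ { nothing → acc λ m → acc-root l (∈-++⁻ loop m)
                           ; (just v) → acc-embed just-embedding (converseWF ℳ l v) }
    }
    where
    open IsModelOf
    transitive′ : T (isTransitive L) → Transitive N
    transitive′ t {just v} {x} {y} = transitive-embed just-embedding (transitive ℳ t) {v} {x} {y}
    transitive′ t {nothing} {x} {y} m m′ with ∈-++⁻ loop m
    ... | inj₁ k with ∈-loop⁻ k
    ...   | _ , refl = m′
    transitive′ t {nothing} {x} {y} m m′ | inj₂ k with ∈-map⁻ just k
    ...   | v , mv , refl with ∈-map⁻ just m′
    ...     | u , mu , refl = ∈-root⁺ (upward t mv mu)
    acc-root : T (hasLöb L) → ∀ {x} → x ∈ loop ⊎ x ∈ map just children → Acc (λ x y → x ∈ next y) x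
    acc-root l (inj₁ k) = ⊥-elim (reflexive⇒¬Löb (proj₁ (∈-loop⁻ k)) l)
    acc-root l (inj₂ k) with ∈-map⁻ just k
    ... | v , _ , refl = acc-embed just-embedding (converseWF ℳ l v)

Coherent : Logic → List Fm → Ty → Set
Coherent L P t = T (isReflexive L) → ∀ {A} → □ A ∈ P → T (t (□ A)) → T (ev t A)

coherent-at : ∀ {M P t} → IsModelOf L M → BoxClosed P → ∀ {w} → Agree (sat M w) P t → Coherent L P t
coherent-at {M = M} ℳ closed {w} ag r {A} m tA =
  subst T (sat-agree ag A (closed m)) (Box.□-sat⁻ M A (subst T (sym (ag m)) tA) (IsModelOf.reflexive ℳ r w))

-- The root sees exactly the successors of w₁ and w₂ (and itself, for reflexive logics);
-- its atoms take the values given by t.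
module Glue {M₁ M₂ : Model} (ℳ₁ : IsModelOf L M₁) (ℳ₂ : IsModelOf L M₂) (w₁ : W M₁) (w₂ : W M₂) (t : Ty) where

  e₁ : Embedding M₁ (M₁ ⊕ M₂)
  e₁ = inj₁-embedding
  e₂ : Embedding M₂ (M₁ ⊕ M₂)
  e₂ = inj₂-embedding

  children : List (W (M₁ ⊕ M₂))
  children = map inj₁ (successors M₁ w₁) ++ map inj₂ (successors M₂ w₂)

  open Rooted L (M₁ ⊕ M₂) children (t ∘ var)

  G : Model
  G = N

  root : W G
  root = nothing

  G-isModel : IsModelOf L G
  G-isModel = isModel (⊕-isModel ℳ₁ ℳ₂) nonempty upward
    where
    open IsModelOf
    nonempty : T (isSerial L) → ∃[ v ] v ∈ children
    nonempty s = let v , m = serial ℳ₁ s w₁ in inj₁ v , ∈-++⁺ˡ (∈-map⁺ inj₁ m)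
    upward : T (isTransitive L) → ∀ {v u} → v ∈ children → u ∈ successors (M₁ ⊕ M₂) v → u ∈ children
    upward tr m m′ with ∈-++⁻ (map inj₁ (successors M₁ w₁)) m
    ... | inj₁ k with ∈-map⁻ inj₁ k
    ...   | _ , k′ , refl with ∈-map⁻ inj₁ m′
    ...     | _ , k″ , refl = ∈-++⁺ˡ (∈-map⁺ inj₁ (transitive ℳ₁ tr k′ k″))
    upward tr m m′ | inj₂ k with ∈-map⁻ inj₂ k
    ...   | _ , k′ , refl with ∈-map⁻ inj₂ m′
    ...     | _ , k″ , refl = ∈-++⁺ʳ _ (∈-map⁺ inj₂ (transitive ℳ₂ tr k′ k″))

  root-□-elim : ∀ B → T (sat G root (□ B)) → T (sat M₁ w₁ (□ B)) × T (sat M₂ w₂ (□ B))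
  root-□-elim B h =
    Box.□-sat⁺ M₁ B (λ {v} m → subst T (sat-embed e₁ B v) (root-□⁻ B h (∈-++⁺ˡ (∈-map⁺ inj₁ m)))) ,
    Box.□-sat⁺ M₂ B (λ {v} m → subst T (sat-embed e₂ B v) (root-□⁻ B h (∈-++⁺ʳ _ (∈-map⁺ inj₂ m))))

  root-□-intro : ∀ B → (T (isReflexive L) → T (sat G root B)) → T (sat M₁ w₁ (□ B)) → T (sat M₂ w₂ (□ B)) →
                 T (sat G root (□ B))
  root-□-intro B here′ h₁ h₂ = root-□⁺ B here′ λ m → at (∈-++⁻ (map inj₁ (successors M₁ w₁)) m)
    where
    at : ∀ {x} → x ∈ map inj₁ (successors M₁ w₁) ⊎ x ∈ map inj₂ (successors M₂ w₂) → T (sat (M₁ ⊕ M₂) x B)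
    at (inj₁ k) with ∈-map⁻ inj₁ k
    ... | v , m , refl = subst T (sym (sat-embed e₁ B v)) (Box.□-sat⁻ M₁ B h₁ m)
    at (inj₂ k) with ∈-map⁻ inj₂ k
    ... | v , m , refl = subst T (sym (sat-embed e₂ B v)) (Box.□-sat⁻ M₂ B h₂ m)

  module _ {P : List Fm} (closed : BoxClosed P) (coherent : Coherent L P t) where

    root-agrees : Agree (sat M₁ w₁) P t → Agree (sat M₂ w₂) P t → ∀ A → BoolComb P A → sat G root A ≡ ev t A
    root-agrees ag₁ ag₂ (var n)  _       = refl
    root-agrees ag₁ ag₂ ⊤ᶠ       _       = refl
    root-agrees ag₁ ag₂ ⊥ᶠ       _       = refl
    root-agrees ag₁ ag₂ (A ∧ᶠ B) (a , b) = cong₂ _∧_ (root-agrees ag₁ ag₂ A a) (root-agrees ag₁ ag₂ B b)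
    root-agrees ag₁ ag₂ (A ∨ᶠ B) (a , b) = cong₂ _∨_ (root-agrees ag₁ ag₂ A a) (root-agrees ag₁ ag₂ B b)
    root-agrees ag₁ ag₂ (A ⇒ B)  (a , b) = cong₂ _⇒ᵇ_ (root-agrees ag₁ ag₂ A a) (root-agrees ag₁ ag₂ B b)
    root-agrees ag₁ ag₂ (□ A)    m       = T-injective
      (λ h → subst T (ag₁ m) (proj₁ (root-□-elim A h)))
      (λ tA → root-□-intro A (λ r → subst T (sym (root-agrees ag₁ ag₂ A (closed m))) (coherent r m tA))
                           (subst T (sym (ag₁ m)) tA) (subst T (sym (ag₂ m)) tA))

    root-monotone : (∀ {p} → p ∈ P → T (t p) → T (sat M₁ w₁ p)) → (∀ {p} → p ∈ P → T (t p) → T (sat M₂ w₂ p)) →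
                    ∀ {A} → Monotone A → BoolComb P A → T (ev t A) → T (sat G root A)
    root-monotone pos₁ pos₂ (mvar n)  _       h = h
    root-monotone pos₁ pos₂ m⊤        _       h = h
    root-monotone pos₁ pos₂ (m∧ a b) (ca , cb) h =
      let hA , hB = ∧ᵇ-elim h in ∧ᵇ-intro (root-monotone pos₁ pos₂ a ca hA) (root-monotone pos₁ pos₂ b cb hB)
    root-monotone pos₁ pos₂ (m∨ {A} {B} a b) (ca , cb) h with ∨ᵇ-elim {ev t A} h
    ... | inj₁ hA = ∨ᵇ-introˡ (sat G root B) (root-monotone pos₁ pos₂ a ca hA)
    ... | inj₂ hB = ∨ᵇ-introʳ (sat G root A) (root-monotone pos₁ pos₂ b cb hB)
    root-monotone pos₁ pos₂ (m□ {A} a) m h =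
      root-□-intro A (λ r → root-monotone pos₁ pos₂ a (closed m) (coherent r m h)) (pos₁ m h) (pos₂ m h)

-- Modal disjunctive interpolants

⋀-⊆V : ∀ {φ} As → (∀ {A} → A ∈ As → A ⊆V φ) → ⋀ As ⊆V φ
⋀-⊆V (A ∷ As) ⊆φ x (inj₁ o) = ⊆φ (here refl) x o
⋀-⊆V {φ} (A ∷ As) ⊆φ x (inj₂ o) = ⋀-⊆V {φ} As (⊆φ ∘ there) x o

⋁-⊆V : ∀ {φ} As → (∀ {A} → A ∈ As → A ⊆V φ) → ⋁ As ⊆V φ
⋁-⊆V (A ∷ As) ⊆φ x (inj₁ o) = ⊆φ (here refl) x o
⋁-⊆V {φ} (A ∷ As) ⊆φ x (inj₂ o) = ⋁-⊆V {φ} As (⊆φ ∘ there) x o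

primes-⊆V : ∀ φ {p} → p ∈ primes φ → p ⊆V φ
primes-⊆V (var n) (here refl) _ o = o
primes-⊆V (A ∧ᶠ B) m x o with ∈-++⁻ (primes A) m
... | inj₁ k = inj₁ (primes-⊆V A k x o)
... | inj₂ k = inj₂ (primes-⊆V B k x o)
primes-⊆V (A ∨ᶠ B) m x o with ∈-++⁻ (primes A) m
... | inj₁ k = inj₁ (primes-⊆V A k x o)
... | inj₂ k = inj₂ (primes-⊆V B k x o)
primes-⊆V (A ⇒ B) m x o with ∈-++⁻ (primes A) m
... | inj₁ k = inj₁ (primes-⊆V A k x o)
... | inj₂ k = inj₂ (primes-⊆V B k x o)
primes-⊆V (□ A) (here refl) _ o = o
primes-⊆V (□ A) (there m)   x o = primes-⊆V A m x o

lit-⊆V : ∀ b → lit A b ⊆V A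
lit-⊆V true  _ o        = o
lit-⊆V false _ (inj₁ o) = o

⋀-monotone : ∀ As → (∀ {A} → A ∈ As → Monotone A) → Monotone (⋀ As)
⋀-monotone []       _ = m⊤
⋀-monotone (A ∷ As) h = m∧ (h (here refl)) (⋀-monotone As (h ∘ there))

⋁-monotone : ∀ As → (∀ {A} → A ∈ As → Monotone A) → Monotone (⋁ As)
⋁-monotone []       _ = m⊥
⋁-monotone (A ∷ As) h = m∨ (h (here refl)) (⋁-monotone As (h ∘ there))

primes-monotone : ∀ {φ p} → Monotone φ → p ∈ primes φ → Monotone p
primes-monotone (mvar n) (here refl) = mvar n
primes-monotone {A ∧ᶠ B} (m∧ a b) m with ∈-++⁻ (primes A) m
... | inj₁ k = primes-monotone a k
... | inj₂ k = primes-monotone b k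
primes-monotone {A ∨ᶠ B} (m∨ a b) m with ∈-++⁻ (primes A) m
... | inj₁ k = primes-monotone a k
... | inj₂ k = primes-monotone b k
primes-monotone (m□ a) (here refl) = m□ a
primes-monotone (m□ a) (there m)   = primes-monotone a m

-- F t is the formula representing the type t in the interpolants: its characteristic formula, or,
-- for monotone φ, the positive part of it.
module Interpolation (L : Logic) (φ ψ θ : Fm) (d : L ⊢ φ ⇒ □ ψ ∨ᶠ □ θ) (F : Ty → Fm)
  (realized : ∀ {M w t} → Agree (sat M w) (primes φ) t → T (sat M w (F t)))
  (glued : ∀ {M₁ M₂ w₁ w₂ t} (ℳ₁ : IsModelOf L M₁) (ℳ₂ : IsModelOf L M₂) →
           Coherent L (primes φ) t → T (ev t φ) → T (sat M₁ w₁ (F t)) → T (sat M₂ w₂ (F t)) →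
           T (sat (Glue.G ℳ₁ ℳ₂ w₁ w₂ t) (Glue.root ℳ₁ ℳ₂ w₁ w₂ t) φ))
  where

  selected : Fm → List Ty
  selected B = filter (λ t → L ⊢? F t ⇒ □ B) (types (primes φ))

  interpolant : Fm → Fm
  interpolant B = ⋁ (map F (selected B))

  interpolant⇒□ : ∀ B → L ⊢ interpolant B ⇒ □ B
  interpolant⇒□ B = ⋁-elim F (selected B) (proj₂ ∘ ∈-filter⁻ (λ t → L ⊢? F t ⇒ □ B) {xs = types (primes φ)})

  interpolant-⊆V : (∀ t → F t ⊆V φ) → ∀ B → interpolant B ⊆V φ
  interpolant-⊆V F⊆φ B = ⋁-⊆V {φ} (map F (selected B)) λ m →
    let t , _ , e = ∈-map⁻ F m in subst (_⊆V φ) (sym e) (F⊆φ t)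

  interpolant-monotone : (∀ t → Monotone (F t)) → ∀ B → Monotone (interpolant B)
  interpolant-monotone mono B = ⋁-monotone (map F (selected B)) λ m →
    let t , _ , e = ∈-map⁻ F m in subst Monotone (sym e) (mono t)

  refuted : ∀ {M w t} B → Agree (sat M w) (primes φ) t → t ∈ types (primes φ) → ¬ T (sat M w (interpolant B)) →
            Countermodel L (F t ⇒ □ B)
  refuted {t = t} B ag m ¬I with decide L (F t ⇒ □ B)
  ... | inj₁ d′ = ⊥-elim (¬I (sat-⋁⁺ F (∈-filter⁺ (λ t → L ⊢? F t ⇒ □ B) m d′) (realized ag)))
  ... | inj₂ c  = c

  φ⇒interpolants : L ⊢ φ ⇒ interpolant ψ ∨ᶠ interpolant θ
  φ⇒interpolants = completeness impossible
    where
    impossible : Countermodel L (φ ⇒ interpolant ψ ∨ᶠ interpolant θ) → ⊥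
    impossible (M , ℳ , w , ¬h) =
      let wφ , ¬I∨J = ⇒ᵇ-counter (sat M w φ) ¬h
          ¬I , ¬J = ∨ᵇ-counter (sat M w (interpolant ψ)) ¬I∨J
          t , mt , ag = types-complete (primes φ) (sat M w)
          M₁ , ℳ₁ , w₁ , ¬1 = refuted ψ ag mt ¬I
          M₂ , ℳ₂ , w₂ , ¬2 = refuted θ ag mt ¬J
          F₁ , ¬□ψ = ⇒ᵇ-counter (sat M₁ w₁ (F t)) ¬1
          F₂ , ¬□θ = ⇒ᵇ-counter (sat M₂ w₂ (F t)) ¬2
          open Glue ℳ₁ ℳ₂ w₁ w₂ t
          tφ = subst T (sat-agree ag φ (BoolComb-primes φ)) wφ
          rootφ = glued ℳ₁ ℳ₂ (coherent-at ℳ (primes-closed φ) ag) tφ F₁ F₂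
      in [ ¬□ψ ∘ proj₁ ∘ root-□-elim ψ , ¬□θ ∘ proj₂ ∘ root-□-elim θ ]′
           (∨ᵇ-elim (⇒ᵇ-elim (sat G root φ) (sound G-isModel d root) rootφ))
char-⊆V : ∀ φ t → char (primes φ) t ⊆V φ
char-⊆V φ t = ⋀-⊆V {φ} (map _ (primes φ)) λ m → let p , m′ , e = ∈-map⁻ _ m in
  subst (_⊆V φ) (sym e) λ x o → primes-⊆V φ m′ x (lit-⊆V (t p) x o)

char-glued : ∀ φ {M₁ M₂ w₁ w₂ t} (ℳ₁ : IsModelOf L M₁) (ℳ₂ : IsModelOf L M₂) →
             Coherent L (primes φ) t → T (ev t φ) →
             T (sat M₁ w₁ (char (primes φ) t)) → T (sat M₂ w₂ (char (primes φ) t)) →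
             T (sat (Glue.G ℳ₁ ℳ₂ w₁ w₂ t) (Glue.root ℳ₁ ℳ₂ w₁ w₂ t) φ)
char-glued φ {w₁ = w₁} {w₂} {t} ℳ₁ ℳ₂ coherent tφ h₁ h₂ =
  subst T (sym (root-agrees (primes-closed φ) coherent (sat-char⁻ h₁) (sat-char⁻ h₂) φ (BoolComb-primes φ))) tφ
  where open Glue ℳ₁ ℳ₂ w₁ w₂ t

posChar : List Fm → Ty → Fm
posChar P t = ⋀ (filterᵇ t P)

posChar-⊆V : ∀ φ t → posChar (primes φ) t ⊆V φ
posChar-⊆V φ t = ⋀-⊆V {φ} (filterᵇ t (primes φ)) (primes-⊆V φ ∘ proj₁ ∘ ∈-filter⁻ (T? ∘ t) {xs = primes φ})

posChar-monotone : ∀ {φ} → Monotone φ → ∀ t → Monotone (posChar (primes φ) t)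
posChar-monotone {φ} mφ t = ⋀-monotone (filterᵇ t (primes φ)) (primes-monotone mφ ∘ proj₁ ∘ ∈-filter⁻ (T? ∘ t))

sat-posChar⁺ : ∀ {M w} → Agree (sat M w) P t → T (sat M w (posChar P t))
sat-posChar⁺ {t = t} ag = sat-⋀⁺ (All.tabulate λ m → let m′ , tp = ∈-filter⁻ (T? ∘ t) m in subst T (sym (ag m′)) tp)

posChar-glued : ∀ {φ} → Monotone φ → ∀ {M₁ M₂ w₁ w₂ t} (ℳ₁ : IsModelOf L M₁) (ℳ₂ : IsModelOf L M₂) →
            Coherent L (primes φ) t → T (ev t φ) →
            T (sat M₁ w₁ (posChar (primes φ) t)) → T (sat M₂ w₂ (posChar (primes φ) t)) →
            T (sat (Glue.G ℳ₁ ℳ₂ w₁ w₂ t) (Glue.root ℳ₁ ℳ₂ w₁ w₂ t) φ)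
posChar-glued {φ = φ} mφ {w₁ = w₁} {w₂} {t} ℳ₁ ℳ₂ coherent tφ h₁ h₂ =
  root-monotone (primes-closed φ) coherent (positive h₁) (positive h₂) mφ (BoolComb-primes φ) tφ
  where
  open Glue ℳ₁ ℳ₂ w₁ w₂ t
  positive : ∀ {M w} → T (sat M w (posChar (primes φ) t)) → ∀ {p} → p ∈ primes φ → T (t p) → T (sat M w p)
  positive h m tp = All.lookup (sat-⋀⁻ _ h) (∈-filter⁺ (T? ∘ t) m tp)

theorem5p10 : (L : Logic) → MDIP L × mMDIP L
theorem5p10 L = mdip , mmdip
  where
  mdip : MDIP L
  mdip φ ψ θ d =
    interpolant ψ , interpolant θ ,
    interpolant-⊆V (char-⊆V φ) ψ , interpolant-⊆V (char-⊆V φ) θ ,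
    φ⇒interpolants , interpolant⇒□ ψ , interpolant⇒□ θ
    where open Interpolation L φ ψ θ d (char (primes φ)) sat-char⁺ (char-glued φ)

  mmdip : mMDIP L
  mmdip φ ψ θ mφ d =
    interpolant ψ , interpolant θ ,
    interpolant-monotone (posChar-monotone mφ) ψ , interpolant-monotone (posChar-monotone mφ) θ ,
    interpolant-⊆V (posChar-⊆V φ) ψ , interpolant-⊆V (posChar-⊆V φ) θ ,
    φ⇒interpolants , interpolant⇒□ ψ , interpolant⇒□ θ
    where open Interpolation L φ ψ θ d (posChar (primes φ)) sat-posChar⁺ (posChar-glued mφ)
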